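{- Let $g,d$ be positive integers and $\preceq$ a relaxed monomial order on $\mathbb{N}^d$. Then $O_{g,d}(\preceq)\in\operatorname{R}_\preceq(\mathcal{S}_{g,d})$.
   Context: A generalized numerical semigroup (GNS) in $\mathbb{N}^d$ is a submonoid $S$ of $(\mathbb{N}^d,+)$ with $\operatorname{H}(S)=\mathbb{N}^d\setminus S$ finite; $|\operatorname{H}(S)|$ is its genus; $\mathcal{S}_{g,d}$ is the set of GNSs in $\mathbb{N}^d$ of genus $g$. $\operatorname{P}_d$ is the set of permutations of $\{1,\ldots,d\}$, acting by $\sigma(\sum x_i\mathbf{e}_i)=\sum x_i\mathbf{e}_{\sigma(i)}$ ($\mathbf{e}_i$ standard basis) and elementwise on sets; $[S]_\simeq=\{\sigma(S)\mid\sigma\in\operatorname{P}_d\}$. A relaxed monomial order is a total order $\preceq$ on $\mathbb{N}^d$ with $\mathbf{0}\preceq\mathbf{v}$ for all $\mathbf{v}$ and such that $\mathbf{v}\prec\mathbf{w}$ implies $\mathbf{v}\prec\mathbf{w}+\mathbf{u}$ for all $\mathbf{u}$. For $S,S'\in\mathcal{S}_{g,d}$ with gaps $\mathbf{h}_1\prec\cdots\prec\mathbf{h}_g$ and $\mathbf{h}'_1\prec\cdots\prec\mathbf{h}'_g$, $S\preceq_{\operatorname{R}}S'$ means $S=S'$ or $\mathbf{h}_r\prec\mathbf{h}'_r$ for $r=\min\{i\mid\mathbf{h}_i\neq\mathbf{h}'_i\}$; $\operatorname{R}_\preceq(S)=\min_{\preceq_{\operatorname{R}}}[S]_\simeq$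 and $\operatorname{R}_\preceq(\mathcal{S}_{g,d})=\{\operatorname{R}_\preceq(S)\mid S\in\mathcal{S}_{g,d}\}$. If $\mathbf{0}=\mathbf{s}_0\prec\mathbf{s}_1\prec\cdots\prec\mathbf{s}_g$ are the $g+1$ smallest elements of $\mathbb{N}^d$ with respect to $\preceq$, the ordinary GNS is $O_{g,d}(\preceq)=\{\mathbf{x}\in\mathbb{N}^d\mid\mathbf{s}_g\prec\mathbf{x}\}\cup\{\mathbf{0}\}$, a GNS of genus $g$. -}

module Defs where

open import Level using (0ℓ)
open import Data.Nat using (ℕ; zero; suc; _+_)
import Data.Fin as Fin
open import Data.Fin using (Fin; fromℕ) renaming (_<_ to _<ᶠ_)
open import Data.Vec using (Vec; []; _∷_; zipWith; replicate; lookup; tabulate; toList)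
open import Data.List using (List; []; _∷_; length)
open import Data.List.Membership.Propositional using (_∈_)
open import Data.List.Relation.Unary.Linked using (Linked)
open import Data.List.Relation.Unary.Unique.Propositional using (Unique)
open import Data.Product using (Σ; ∃; _×_; _,_)
open import Data.Sum using (_⊎_)
open import Data.Fin.Permutation using (Permutation′; _⟨$⟩ˡ_)
open import Relation.Binary using (Rel; IsTotalOrder)
open import Relation.Binary.PropositionalEquality using (_≡_; _≢_)
open import Relation.Nullary using (¬_)
open import Function using (_⇔_)

ℕ^ : ℕ → Set
ℕ^ d = Vec ℕ d

𝟎 : ∀ {d} → ℕ^ d
𝟎 = replicate _ 0

_⊕_ : ∀ {d} → ℕ^ d → ℕ^ d → ℕ^ d
_⊕_ = zipWith _+_

Subset : ℕ → Set₁
Subset d = ℕ^ d → Set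

_≐_ : ∀ {d} → Subset d → Subset d → Set
S ≐ T = ∀ x → (S x ⇔ T x)

IsSubmonoid : ∀ {d} → Subset d → Set
IsSubmonoid S = S 𝟎 × (∀ x y → S x → S y → S (x ⊕ y))

IsGapList : ∀ {d} → Subset d → List (ℕ^ d) → Set
IsGapList S hs = ∀ x → ((¬ S x) ⇔ (x ∈ hs))

-- S is a generalized numerical semigroup of genus g:
-- a submonoid whose set of gaps is finite with exactly g elements
IsGNS : ∀ {d} → ℕ → Subset d → Set
IsGNS {d} g S = IsSubmonoid S ×
  Σ (List (ℕ^ d)) λ hs → Unique hs × IsGapList S hs × length hs ≡ g

record RelaxedMonomialOrder (d : ℕ) : Set₁ where
  field
    _⪯_ : Rel (ℕ^ d) 0ℓ
    isTotalOrder : IsTotalOrder _≡_ _⪯_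
  _≺_ : Rel (ℕ^ d) 0ℓ
  v ≺ w = (v ⪯ w) × (v ≢ w)
  field
    zero-least : ∀ v → 𝟎 ⪯ v
    compatible : ∀ v w u → v ≺ w → v ≺ (w ⊕ u)

module _ {d : ℕ} (ord : RelaxedMonomialOrder d) where
  open RelaxedMonomialOrder ord

  data LexLt : List (ℕ^ d) → List (ℕ^ d) → Set where
    here  : ∀ {x y xs ys} → x ≺ y → LexLt (x ∷ xs) (y ∷ ys)
    there : ∀ {x xs ys} → LexLt xs ys → LexLt (x ∷ xs) (x ∷ ys)

  IsSortedGaps : Subset d → List (ℕ^ d) → Set
  IsSortedGaps S hs = Linked _≺_ hs × IsGapList S hs

  _⪯R_ : Subset d → Subset d → Set
  S ⪯R S' = (S ≐ S') ⊎
    (Σ (List (ℕ^ d)) λ hs → Σ (List (ℕ^ d)) λ hs' →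
       IsSortedGaps S hs × IsSortedGaps S' hs' × LexLt hs hs')

  -- ordinary GNS O_{g,d}(⪯), given the g+1 smallest elements
  -- s₀ ≺ s₁ ≺ ⋯ ≺ s_g of ℕ^d
  IsSmallest : (g : ℕ) → Vec (ℕ^ d) (suc g) → Set
  IsSmallest g s =
    (lookup s Fin.zero ≡ 𝟎) ×
    (∀ i j → i <ᶠ j → lookup s i ≺ lookup s j) ×
    (∀ x → (∀ i → x ≢ lookup s i) → lookup s (fromℕ g) ≺ x)

  Ordinary : (g : ℕ) → Vec (ℕ^ d) (suc g) → Subset d
  Ordinary g s x = (lookup s (fromℕ g) ≺ x) ⊎ (x ≡ 𝟎)

-- action of a permutation σ of {1..d}: σ(Σ xᵢ eᵢ) = Σ xᵢ e_{σ(i)},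
-- i.e. the σ(i)-th coordinate of σ(x) is xᵢ
act : ∀ {d} → Permutation′ d → ℕ^ d → ℕ^ d
act σ x = tabulate (λ j → lookup x (σ ⟨$⟩ˡ j))

actSet : ∀ {d} → Permutation′ d → Subset d → Subset d
actSet σ S y = ∃ λ x → S x × act σ x ≡ y

-- T = R_⪯(S) = min_{⪯_R} [S]_≃
IsRepresentative : ∀ {d} → RelaxedMonomialOrder d → Subset d → Subset d → Set
IsRepresentative ord T S =
  (∃ λ σ → T ≐ actSet σ S) × (∀ σ → _⪯R_ ord T (actSet σ S))

-- The gaps of O_{g,d}(⪯) are s₁ ≺ ⋯ ≺ s_g, the g smallest nonzero points. A GNS T of genus g,
-- in particular any σ(O_{g,d}(⪯)), has g distinct nonzero gaps h₁ ≺ ⋯ ≺ h_g. At the first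
-- index r with s_r ≠ h_r, the point h_r is nonzero and not among s₁, …, s_{r-1}; so it is
-- either a later s_j or lies above s_g, and in both cases s_r ≺ h_r. Hence O_{g,d}(⪯) is
-- ⪯_R-below every GNS of genus g, and in particular it is its own representative.

{-# OPTIONS --safe #-}
module Submission where

open import Defs
open import Level using (0ℓ)
open import Data.Nat using (ℕ; suc; _+_; _≤_; z<s; s<s)
import Data.Nat.Properties as ℕ
open import Data.Fin using (fromℕ) renaming (_<_ to _<ᶠ_)
import Data.Fin as Fin
import Data.Fin.Properties as Fin
open import Data.Vec as Vec using (Vec; []; _∷_; lookup; toList)
import Data.Vec.Properties as Vec
open import Data.Vec.Membership.Propositional using () renaming (_∈_ to _∈ᵥ_)
open import Data.Vec.Membership.Propositional.Properties using (∈-lookup; ∈-toList⁺)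
open import Data.Vec.Relation.Unary.All.Properties using (toList⁺; lookup⁻)
open import Data.List using (List; []; _∷_; length; map)
import Data.List.Properties as List
open import Data.List.Membership.Propositional using (_∈_; _∉_)
open import Data.List.Membership.Propositional.Properties using (∈-map⁺; ∈-map⁻)
import Data.List.Membership.DecPropositional as DecMembership
open import Data.List.Relation.Unary.Any using (here; there)
open import Data.List.Relation.Unary.All as All using (All; []; _∷_)
open import Data.List.Relation.Unary.AllPairs as AllPairs using (_∷_)
open import Data.List.Relation.Unary.Linked as Linked using (Linked; []; [-]; _∷_)
open import Data.List.Relation.Unary.Linked.Properties using (Linked⇒All; Linked⇒AllPairs)
open import Data.List.Relation.Unary.Unique.Propositional using (Unique)
import Data.List.Relation.Unary.Unique.Propositional.Properties as Unique
open import Data.List.Relation.Binary.Permutation.Propositional using (↭-sym; ↭⇒↭ₛ)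
open import Data.List.Relation.Binary.Permutation.Propositional.Properties using (∈-resp-↭; ↭-length)
import Data.List.Relation.Binary.Permutation.Setoid.Properties as PermutationSetoid
import Data.List.Sort as Sort
open import Data.Product using (Σ; _×_; _,_; proj₁; proj₂)
open import Data.Sum as Sum using (_⊎_; inj₁; inj₂)
open import Relation.Nullary using (¬_; Dec; yes; no; contradiction)
open import Relation.Nullary.Decidable using (_⊎-dec_; map′)
open import Relation.Unary using (Decidable)
open import Relation.Binary using (IsTotalOrder; IsStrictTotalOrder; DecTotalOrder; tri<; tri≈; tri>)
open import Relation.Binary.Consequences using (total∧dec⇒dec)
import Relation.Binary.Construct.NonStrictToStrict as NonStrictToStrict
open import Relation.Binary.PropositionalEquality using (_≡_; refl; sym; trans; cong; cong₂; subst; setoid; module ≡-Reasoning)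
open import Function using (_⇔_; _∘_; case_of_)
open import Function.Bundles using (mk⇔; Equivalence)
open import Data.Fin.Permutation using (Permutation′; _⟨$⟩ˡ_; _⟨$⟩ʳ_; inverseʳ; flip) renaming (id to idₚ)

open Equivalence using (to; from)

lookup-ext : ∀ {A : Set} {n} {u v : Vec A n} → (∀ i → lookup u i ≡ lookup v i) → u ≡ v
lookup-ext {u = u} {v} eq = trans (sym (Vec.tabulate∘lookup u)) (trans (Vec.tabulate-cong eq) (Vec.tabulate∘lookup v))

toList-head∷tail : ∀ {A : Set} {n} (v : Vec A (suc n)) → toList v ≡ lookup v Fin.zero ∷ toList (Vec.tail v)
toList-head∷tail (x ∷ v) = refl

toList-Linked : ∀ {A : Set} {R : A → A → Set} {n} (v : Vec A (suc n)) →
  (∀ i j → i <ᶠ j → R (lookup v i) (lookup v j)) → Linked R (toList v)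
toList-Linked (x ∷ []) increasing = [-]
toList-Linked (x ∷ y ∷ v) increasing =
  increasing Fin.zero (Fin.suc Fin.zero) z<s ∷
  toList-Linked (y ∷ v) (λ i j i<j → increasing (Fin.suc i) (Fin.suc j) (s<s i<j))

⊕-identityˡ : ∀ {d} (x : ℕ^ d) → 𝟎 ⊕ x ≡ x
⊕-identityˡ x = trans (Vec.zipWith-replicate₁ _+_ 0 x) (Vec.map-id x)

-- Constructively a gap list determines a subset only up to double negation, hence Decidable.
gapList-⊆ : ∀ {d} {S T : Subset d} {hs} → Decidable T → IsGapList S hs → IsGapList T hs → ∀ {x} → S x → T x
gapList-⊆ T? gapsS gapsT {x} Sx with T? x
... | yes Tx = Tx
... | no ¬Tx = contradiction Sx (from (gapsS x) (to (gapsT x) ¬Tx))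

gapList-≐ : ∀ {d} {S T : Subset d} {hs} → Decidable S → Decidable T → IsGapList S hs → IsGapList T hs → S ≐ T
gapList-≐ S? T? gapsS gapsT x = mk⇔ (gapList-⊆ T? gapsS gapsT) (gapList-⊆ S? gapsT gapsS)

module _ {d : ℕ} (σ : Permutation′ d) where

  lookup-act : ∀ x j → lookup (act σ x) j ≡ lookup x (σ ⟨$⟩ˡ j)
  lookup-act x = Vec.lookup∘tabulate _

  act-flip-inverse : ∀ y → act σ (act (flip σ) y) ≡ y
  act-flip-inverse y = lookup-ext λ j → begin
    lookup (act σ (act (flip σ) y)) j  ≡⟨ lookup-act (act (flip σ) y) j ⟩
    lookup (act (flip σ) y) (σ ⟨$⟩ˡ j) ≡⟨ Vec.lookup∘tabulate _ (σ ⟨$⟩ˡ j) ⟩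
    lookup y (σ ⟨$⟩ʳ (σ ⟨$⟩ˡ j))       ≡⟨ cong (lookup y) (inverseʳ σ) ⟩
    lookup y j                          ∎
    where open ≡-Reasoning

  act-⊕ : ∀ x y → act σ (x ⊕ y) ≡ act σ x ⊕ act σ y
  act-⊕ x y = lookup-ext λ j → begin
    lookup (act σ (x ⊕ y)) j                           ≡⟨ lookup-act (x ⊕ y) j ⟩
    lookup (x ⊕ y) (σ ⟨$⟩ˡ j)                          ≡⟨ Vec.lookup-zipWith _+_ (σ ⟨$⟩ˡ j) x y ⟩
    lookup x (σ ⟨$⟩ˡ j) + lookup y (σ ⟨$⟩ˡ j)          ≡⟨ sym (cong₂ _+_ (lookup-act x j) (lookup-act y j)) ⟩
    lookup (act σ x) j + lookup (act σ y) j            ≡⟨ sym (Vec.lookup-zipWith _+_ j (act σ x) (act σ y)) ⟩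
    lookup (act σ x ⊕ act σ y) j                       ∎
    where open ≡-Reasoning

  act-𝟎 : act σ 𝟎 ≡ 𝟎
  act-𝟎 = lookup-ext λ j → trans (lookup-act 𝟎 j)
    (trans (Vec.lookup-replicate (σ ⟨$⟩ˡ j) 0) (sym (Vec.lookup-replicate j 0)))

act-injective : ∀ {d} (σ : Permutation′ d) {x y} → act σ x ≡ act σ y → x ≡ y
act-injective σ {x} {y} eq = begin
  x                         ≡⟨ sym (act-flip-inverse (flip σ) x) ⟩
  act (flip σ) (act σ x)    ≡⟨ cong (act (flip σ)) eq ⟩
  act (flip σ) (act σ y)    ≡⟨ act-flip-inverse (flip σ) y ⟩
  y                         ∎
  where open ≡-Reasoning

module _ {d : ℕ} (σ : Permutation′ d) {S : Subset d} where

  actSet-⇔ : ∀ y → actSet σ S y ⇔ S (act (flip σ) y)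
  actSet-⇔ y = mk⇔
    (λ { (x , Sx , refl) → subst S (sym (act-flip-inverse (flip σ) x)) Sx })
    (λ S[σ⁻¹y] → act (flip σ) y , S[σ⁻¹y] , act-flip-inverse σ y)

  actSet-decidable : Decidable S → Decidable (actSet σ S)
  actSet-decidable S? y = map′ (from (actSet-⇔ y)) (to (actSet-⇔ y)) (S? (act (flip σ) y))

  actSet-gapList : ∀ {hs} → IsGapList S hs → IsGapList (actSet σ S) (map (act σ) hs)
  actSet-gapList gaps y = mk⇔
    (λ ¬σSy → subst (_∈ map (act σ) _) (act-flip-inverse σ y)
                (∈-map⁺ (act σ) (to (gaps _) (¬σSy ∘ from (actSet-⇔ y)))))
    (λ y∈ → case ∈-map⁻ (act σ) y∈ of λ { (x , x∈hs , refl) (x′ , Sx′ , σx′≡σx) →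
       from (gaps x) x∈hs (subst S (act-injective σ σx′≡σx) Sx′) })

  actSet-isGNS : ∀ {g} → IsGNS g S → IsGNS g (actSet σ S)
  actSet-isGNS ((S𝟎 , closed) , hs , unique , gaps , genus) =
    ( (𝟎 , S𝟎 , act-𝟎 σ)
    , λ { _ _ (x , Sx , refl) (y , Sy , refl) → x ⊕ y , closed x y Sx Sy , act-⊕ σ x y })
    , map (act σ) hs , Unique.map⁺ (act-injective σ) unique , actSet-gapList gaps
    , trans (List.length-map (act σ) hs) genus

actSet-id : ∀ {d} (S : Subset d) → S ≐ actSet idₚ S
actSet-id S x = mk⇔ (λ Sx → x , Sx , Vec.tabulate∘lookup x)
  (λ { (x , Sx , refl) → subst S (sym (Vec.tabulate∘lookup x)) Sx })

module _ {d : ℕ} (ord : RelaxedMonomialOrder d) where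
  open RelaxedMonomialOrder ord
  open IsTotalOrder isTotalOrder using (antisym; total; reflexive; ≤-respˡ-≈)
    renaming (refl to ⪯-refl; trans to ⪯-trans)

  _≟ᵥ_ : (x y : ℕ^ d) → Dec (x ≡ y)
  _≟ᵥ_ = Vec.≡-dec ℕ._≟_

  ≺-isStrictTotalOrder : IsStrictTotalOrder _≡_ _≺_
  ≺-isStrictTotalOrder = NonStrictToStrict.<-isStrictTotalOrder₁ _≡_ _⪯_ _≟ᵥ_ isTotalOrder

  open IsStrictTotalOrder ≺-isStrictTotalOrder using (compare; _<?_)
    renaming (trans to ≺-trans; irrefl to ≺-irrefl; asym to ≺-asym)

  ≺⇒⋡ : ∀ {x y} → x ≺ y → ¬ y ⪯ x
  ≺⇒⋡ = NonStrictToStrict.<⇒≱ _≡_ _⪯_ antisym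

  ⪯-≺-trans : ∀ {x y z} → x ⪯ y → y ≺ z → x ≺ z
  ⪯-≺-trans = NonStrictToStrict.≤-<-trans _≡_ _⪯_ ⪯-trans antisym ≤-respˡ-≈

  open DecMembership _≟ᵥ_ using (_∈?_)

  ⪯-decTotalOrder : DecTotalOrder 0ℓ 0ℓ 0ℓ
  ⪯-decTotalOrder = record
    { isDecTotalOrder = record
      { isTotalOrder = isTotalOrder
      ; _≟_ = _≟ᵥ_
      ; _≤?_ = total∧dec⇒dec reflexive antisym total _≟ᵥ_ } }

  Linked⇒head-below : ∀ {x xs} → Linked _≺_ (x ∷ xs) → All (x ≺_) xs
  Linked⇒head-below [-] = []
  Linked⇒head-below (x≺y ∷ sorted) = Linked⇒All ≺-trans x≺y sorted

  sorted∧unique⇒strictlySorted : ∀ {xs} → Linked _⪯_ xs → Unique xs → Linked _≺_ xs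
  sorted∧unique⇒strictlySorted [] _ = []
  sorted∧unique⇒strictlySorted [-] _ = [-]
  sorted∧unique⇒strictlySorted (x⪯y ∷ sorted) ((x≢y ∷ _) ∷ unique) =
    (x⪯y , x≢y) ∷ sorted∧unique⇒strictlySorted sorted unique

  sortedGapList : ∀ {S : Subset d} {hs} → Unique hs → IsGapList S hs →
    Σ (List (ℕ^ d)) λ hs′ → IsSortedGaps ord S hs′ × length hs′ ≡ length hs
  sortedGapList {S} {hs} unique gaps =
    sort hs , (sorted∧unique⇒strictlySorted (sort-↗ hs) unique′ , gaps′) , ↭-length (sort-↭ hs)
    where
    open Sort ⪯-decTotalOrder using (sort; sort-↗; sort-↭)
    unique′ : Unique (sort hs)
    unique′ = PermutationSetoid.Unique-resp-↭ (setoid (ℕ^ d)) (↭⇒↭ₛ (↭-sym (sort-↭ hs))) unique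
    gaps′ : IsGapList S (sort hs)
    gaps′ x = mk⇔ (∈-resp-↭ (↭-sym (sort-↭ hs)) ∘ to (gaps x)) (from (gaps x) ∘ ∈-resp-↭ (sort-↭ hs))

  𝟎∷sortedGaps : ∀ {T ts} → T 𝟎 → IsSortedGaps ord T ts → Linked _≺_ (𝟎 ∷ ts)
  𝟎∷sortedGaps {ts = []} _ _ = [-]
  𝟎∷sortedGaps {ts = t ∷ _} T𝟎 (sorted , gapsT) =
    (zero-least t , λ { refl → from (gapsT 𝟎) (here refl) T𝟎 }) ∷ sorted

  IsInitialAbove : ℕ^ d → List (ℕ^ d) → Set
  IsInitialAbove p ts = ∀ h → p ≺ h → h ∉ ts → All (_≺ h) ts

  isInitialAbove-tail : ∀ {p t ts} → p ≺ t → IsInitialAbove p (t ∷ ts) → IsInitialAbove t ts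
  isInitialAbove-tail p≺t initial h t≺h h∉ts = All.tail (initial h (≺-trans p≺t t≺h) h∉t∷ts)
    where
    h∉t∷ts : h ∉ _ ∷ _
    h∉t∷ts (here h≡t) = ≺-irrefl (sym h≡t) t≺h
    h∉t∷ts (there h∈ts) = h∉ts h∈ts

  -- At the first difference t ≢ t′, the case t′ ≺ t is impossible: t′ would be a point
  -- above p missing from ts, hence above all of ts.
  initialAbove-lexMinimal : ∀ {p ts ts′} → Linked _≺_ (p ∷ ts) → IsInitialAbove p ts →
    Linked _≺_ (p ∷ ts′) → length ts ≡ length ts′ → ts ≡ ts′ ⊎ LexLt ord ts ts′
  initialAbove-lexMinimal {ts = []} {[]} _ _ _ _ = inj₁ refl
  initialAbove-lexMinimal {ts = []} {_ ∷ _} _ _ _ ()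
  initialAbove-lexMinimal {ts = _ ∷ _} {[]} _ _ _ ()
  initialAbove-lexMinimal {ts = t ∷ ts} {t′ ∷ ts′} (p≺t ∷ sorted) initial (p≺t′ ∷ sorted′) len
    with compare t t′
  ... | tri< t≺t′ _ _ = inj₂ (here t≺t′)
  ... | tri≈ _ refl _ = Sum.map (cong (t ∷_)) there
          (initialAbove-lexMinimal sorted (isInitialAbove-tail p≺t initial) sorted′ (ℕ.suc-injective len))
  ... | tri> _ _ t′≺t = contradiction t′≺t (≺-asym (All.head (initial t′ p≺t′ t′∉t∷ts)))
    where
    t′∉t∷ts : t′ ∉ t ∷ ts
    t′∉t∷ts t′∈ = ≺-irrefl refl (All.lookup (t′≺t ∷ All.map (≺-trans t′≺t) (Linked⇒head-below sorted)) t′∈)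

  lookup-⪯-last : ∀ {n} (v : Vec (ℕ^ d) (suc n)) → (∀ i j → i <ᶠ j → lookup v i ≺ lookup v j) →
    ∀ i → lookup v i ⪯ lookup v (fromℕ n)
  lookup-⪯-last {n} v increasing i with i Fin.≟ fromℕ n
  ... | yes refl = ⪯-refl
  ... | no i≢last = proj₁ (increasing i (fromℕ n) (Fin.≤∧≢⇒< (Fin.≤fromℕ i) i≢last))

  module _ {g : ℕ} (s : Vec (ℕ^ d) (suc g)) (smallest : IsSmallest ord g s) where

    private
      O : Subset d
      O = Ordinary ord g s

      sₘ : ℕ^ d
      sₘ = lookup s (fromℕ g)

      gaps : List (ℕ^ d)
      gaps = toList (Vec.tail s)

      increasing : ∀ i j → i <ᶠ j → lookup s i ≺ lookup s j
      increasing = proj₁ (proj₂ smallest)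

      toList-s : toList s ≡ 𝟎 ∷ gaps
      toList-s = trans (toList-head∷tail s) (cong (_∷ gaps) (proj₁ smallest))

      𝟎∷gaps-sorted : Linked _≺_ (𝟎 ∷ gaps)
      𝟎∷gaps-sorted = subst (Linked _≺_) toList-s (toList-Linked s increasing)

      gaps-⪯-sₘ : All (_⪯ sₘ) gaps
      gaps-⪯-sₘ = All.tail (subst (All (_⪯ sₘ)) toList-s (toList⁺ (lookup⁻ (lookup-⪯-last s increasing))))

      length-gaps : length gaps ≡ g
      length-gaps = Vec.length-toList (Vec.tail s)

      sₘ-≺-rest : ∀ x → x ∉ 𝟎 ∷ gaps → sₘ ≺ x
      sₘ-≺-rest x x∉ = proj₂ (proj₂ smallest) x λ i x≡sᵢ →
        x∉ (subst (x ∈_) toList-s (∈-toList⁺ (subst (_∈ᵥ s) (sym x≡sᵢ) (∈-lookup i s))))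

    ordinary-gapList : IsGapList O gaps
    ordinary-gapList x = mk⇔ gap⇒∈ ∈⇒gap
      where
      gap⇒∈ : ¬ O x → x ∈ gaps
      gap⇒∈ ¬Ox with x ∈? 𝟎 ∷ gaps
      ... | yes (here refl) = contradiction (inj₂ refl) ¬Ox
      ... | yes (there x∈gaps) = x∈gaps
      ... | no x∉ = contradiction (inj₁ (sₘ-≺-rest x x∉)) ¬Ox
      ∈⇒gap : x ∈ gaps → ¬ O x
      ∈⇒gap x∈gaps (inj₁ sₘ≺x) = ≺⇒⋡ sₘ≺x (All.lookup gaps-⪯-sₘ x∈gaps)
      ∈⇒gap x∈gaps (inj₂ refl) = ≺-irrefl refl (All.lookup (Linked⇒head-below 𝟎∷gaps-sorted) x∈gaps)

    ordinary-isInitialAbove : IsInitialAbove 𝟎 gaps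
    ordinary-isInitialAbove h 𝟎≺h h∉gaps = All.map (λ x⪯sₘ → ⪯-≺-trans x⪯sₘ sₘ≺h) gaps-⪯-sₘ
      where
      sₘ≺h : sₘ ≺ h
      sₘ≺h = sₘ-≺-rest h λ { (here refl) → ≺-irrefl refl 𝟎≺h ; (there h∈gaps) → h∉gaps h∈gaps }

    ordinary-decidable : Decidable O
    ordinary-decidable x = sₘ <? x ⊎-dec x ≟ᵥ 𝟎

    ordinary-isGNS : IsGNS g O
    ordinary-isGNS = (inj₂ refl , closed) , gaps , unique , ordinary-gapList , length-gaps
      where
      closed : ∀ x y → O x → O y → O (x ⊕ y)
      closed x y (inj₁ sₘ≺x) _ = inj₁ (compatible sₘ x y sₘ≺x)
      closed _ y (inj₂ refl) Oy = subst O (sym (⊕-identityˡ y)) Oy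
      unique : Unique gaps
      unique = AllPairs.map proj₂ (Linked⇒AllPairs ≺-trans (Linked.tail 𝟎∷gaps-sorted))

    ordinary-⪯R-least : ∀ {T} → Decidable T → IsGNS g T → _⪯R_ ord O T
    ordinary-⪯R-least {T} T? ((T𝟎 , _) , ts , unique , gapsT , genusT)
      with sortedGapList unique gapsT
    ... | ts′ , sortedGapsT , length-ts′
      with initialAbove-lexMinimal 𝟎∷gaps-sorted ordinary-isInitialAbove (𝟎∷sortedGaps T𝟎 sortedGapsT)
             (trans length-gaps (sym (trans length-ts′ genusT)))
    ... | inj₁ refl = inj₁ (gapList-≐ ordinary-decidable T? ordinary-gapList (proj₂ sortedGapsT))
    ... | inj₂ gaps<ts′ =
      inj₂ (gaps , ts′ , (Linked.tail 𝟎∷gaps-sorted , ordinary-gapList) , sortedGapsT , gaps<ts′)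

mainTheorem13 : (g d : ℕ) → 1 ≤ g → 1 ≤ d →
    (ord : RelaxedMonomialOrder d) →
    (s : Vec (ℕ^ d) (suc g)) → IsSmallest ord g s →
    Σ (Subset d) λ S → IsGNS g S × IsRepresentative ord (Ordinary ord g s) S
mainTheorem13 g d _ _ ord s smallest =
  O , ordinary-isGNS ord s smallest , (idₚ , actSet-id O) ,
  λ σ → ordinary-⪯R-least ord s smallest
          (actSet-decidable σ (ordinary-decidable ord s smallest))
          (actSet-isGNS σ (ordinary-isGNS ord s smallest))
  where
  O : Subset d
  O = Ordinary ord g s
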